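{- Let $G$ be a graph whose vertex set can be partitioned into sets $A$ and $B$ such that $B$ is an independent set and the induced subgraph $G[A]$ is a comparability graph. Then $G$ is permutationally $1$-$11$-representable.
   Context: A comparability graph is a graph admitting a transitive orientation (if $u\to v$ and $v\to z$ are arcs then $u\to z$ is an arc). For a word $w$ and letters $x,y$, let $w|_{\{x,y\}}$ be the subsequence of $w$ of all occurrences of $x$ and $y$. A word $w$ over $V$ $1$-$11$-represents a graph $G=(V,E)$ if for all distinct $x,y\in V$, the total number of occurrences of the factors $xx$ and $yy$ in $w|_{\{x,y\}}$ is at most $1$ if and only if $xy\in E$. $G$ is permutationally $1$-$11$-representable if it has such a representing word that is a concatenation of permutations of $V$ (words containing each vertex exactly once). -}

module Defs where

open import Data.Nat using (ℕ; zero; suc; _≤_)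
open import Data.Bool using (Bool; true; false; T)
open import Data.Fin using (Fin)
open import Data.Fin.Properties using (_≟_)
open import Data.List using (List; []; _∷_; filter; concat; allFin)
open import Data.List.Relation.Binary.Permutation.Propositional using (_↭_)
open import Data.List.Relation.Unary.All using (All)
open import Data.Product using (Σ; _×_; ∃)
open import Data.Sum using (_⊎_)
open import Relation.Nullary using (¬_; Dec; yes; no)
open import Relation.Binary.PropositionalEquality using (_≡_)
open import Function.Bundles using (_⇔_)

record Graph (n : ℕ) : Set where
  field
    adj   : Fin n → Fin n → Bool
    sym   : ∀ x y → adj x y ≡ adj y x
    irrefl : ∀ x → adj x x ≡ false
open Graph public

Edge : ∀ {n} → Graph n → Fin n → Fin n → Set
Edge G x y = T (adj G x y)

Subset : ℕ → Set
Subset n = Fin n → Bool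

In : ∀ {n} → Subset n → Fin n → Set
In S x = T (S x)

Independent : ∀ {n} → Graph n → Subset n → Set
Independent G B = ∀ x y → In B x → In B y → ¬ Edge G x y

IsTransitiveOrientationOn : ∀ {n} → Graph n → Subset n →
                            (Fin n → Fin n → Set) → Set
IsTransitiveOrientationOn G A O =
  (∀ x y → O x y → In A x × In A y × Edge G x y) ×
  (∀ x y → In A x → In A y → Edge G x y → O x y ⊎ O y x) ×
  (∀ x y → O x y → ¬ O y x) ×
  (∀ x y z → O x y → O y z → O x z)

InducedIsComparability : ∀ {n} → Graph n → Subset n → Set₁
InducedIsComparability {n} G A =
  Σ (Fin n → Fin n → Set) (λ O → IsTransitiveOrientationOn G A O)

Word : ℕ → Set
Word n = List (Fin n)

isXY : ∀ {n} → Fin n → Fin n → Fin n → Bool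
isXY x y z with z ≟ x | z ≟ y
... | yes _ | _     = true
... | no _  | yes _ = true
... | no _  | no _  = false

restrict : ∀ {n} → Fin n → Fin n → Word n → Word n
restrict x y w = filter (λ z → T? (isXY x y z)) w
  where
  T? : (b : Bool) → Dec (T b)
  T? true  = yes _
  T? false = no (λ ())

-- Number of (possibly overlapping) occurrences of factors aa (any letter a)
-- in a word; applied to w|_{x,y} this is the total number of occurrences of
-- the factors xx and yy.
squaresFrom : ∀ {n} → Fin n → Word n → ℕ
squaresFrom a []      = 0
squaresFrom a (b ∷ w) with a ≟ b
... | yes _ = suc (squaresFrom b w)
... | no _  = squaresFrom b w

countSquares : ∀ {n} → Word n → ℕ
countSquares []      = 0
countSquares (a ∷ w) = squaresFrom a w

Represents-1-11 : ∀ {n} → Graph n → Word n → Set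
Represents-1-11 G w =
  ∀ x y → ¬ x ≡ y → (countSquares (restrict x y w) ≤ 1) ⇔ Edge G x y

IsPermutation : ∀ {n} → Word n → Set
IsPermutation {n} p = p ↭ allFin n

PermRep-1-11 : ∀ {n} → Graph n → Set
PermRep-1-11 {n} G =
  Σ (List (Word n)) λ ps → All IsPermutation ps × Represents-1-11 G (concat ps)

-- Every permutation used here lists the vertices sorted by a key.  For x ≠ y each permutation
-- contributes the factor xy or yx to w|{x,y}, so the squares counted are exactly the switches in
-- the relative order of x and y between consecutive permutations, and it suffices to make that
-- order switch at most once precisely on edges.  Let rank be a linear extension of the
-- orientation of G[A].  The sequence opens, for every vertex w, with a permutation listing B and
-- then A, and closes with one listing A and then B; inside A the down-set of w comes first, inside
-- B the vertex w comes first, and otherwise the order is by rank and index.  Comparable pairs of A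
-- thus never switch, whereas incomparable pairs of A and all pairs of B occur in both orders at
-- both ends.  A pair x ∈ A, y ∈ B is ordered yx at the start and xy at the end; in between,
-- every vertex y of B in turn sweeps upwards through A in the order of rank, crossing each
-- neighbour once but each non-neighbour three times.
module Submission where

open import Defs hiding (sym)
open import Data.Bool using (Bool; true; false; not; T; _xor_; if_then_else_)
open import Data.Bool.Properties using (not-involutive; T-≡; T-not-≡)
open import Data.Empty using (⊥-elim)
open import Data.Fin using (Fin; toℕ)
import Data.Fin as Fin
open import Data.Fin.Properties using (_≟_; toℕ<n; toℕ-injective)
import Data.Fin.Properties as Finₚ
open import Data.List using (List; []; _∷_; _++_; concat; concatMap; map; filter; length; allFin; upTo)
open import Data.List.Properties
  using (filter-≐; filter-++; filter-notAll; filter-reject; length-filter; length-tabulate;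
         map-++; map-∘; map-cong; map-concatMap)
open import Data.List.Membership.Propositional using (_∈_; lose)
open import Data.List.Membership.Propositional.Properties using (∈-filter⁺; ∈-allFin; ∈-map⁺; ∈-upTo⁺)
open import Data.List.Relation.Unary.All using (All; []; _∷_)
import Data.List.Relation.Unary.All as All
import Data.List.Relation.Unary.All.Properties as All
open import Data.List.Relation.Unary.AllPairs using (AllPairs; []; _∷_)
import Data.List.Relation.Unary.AllPairs.Properties as AllPairs
open import Data.List.Relation.Unary.Any using (Any; here; there)
import Data.List.Relation.Unary.Linked as Linked
open import Data.List.Relation.Unary.Unique.Propositional using (Unique)
import Data.List.Relation.Unary.Unique.Propositional.Properties as Unique
import Data.List.Relation.Unary.Sorted.TotalOrder.Properties as Sortedₚ
open import Data.List.Relation.Binary.Permutation.Propositional using (_↭_; ↭-sym; ↭⇒↭ₛ)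
open import Data.List.Relation.Binary.Permutation.Propositional.Properties using (∈-resp-↭)
import Data.List.Sort
open import Data.Nat using (ℕ; suc; _+_; _*_; _≤_; _<_; z≤n; s≤s; _<?_)
open import Data.Nat.Properties
  using (≤-refl; ≤-trans; ≤-reflexive; <-≤-trans; <-asym; <⇒≢; ≤∧≢⇒<; ≤⇒≯; n≤1+n; n<1+n;
         m≤m+n; m≤n+m; +-assoc; +-identityʳ; +-cancelʳ-≡; +-mono-≤; +-monoʳ-≤; +-monoˡ-<; +-monoʳ-<;
         +-mono-≤-<; *-suc; *-monoʳ-≤; *-monoʳ-<; ≤-totalOrder; ≤-decTotalOrder; module ≤-Reasoning)
  renaming (_≟_ to _≟ℕ_)
import Data.Nat.Properties as ℕₚ
open import Data.Product using (_×_; _,_; ∃; proj₁; proj₂)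
open import Data.Sum using (_⊎_; inj₁; inj₂)
import Data.Sum as Sum
open import Function using (_∘_; id; flip)
open import Function.Bundles using (Equivalence; _⇔_; mk⇔)
open import Level using (0ℓ)
open import Relation.Binary using (Rel; Transitive; Asymmetric; Trichotomous; tri<; tri≈; tri>)
  renaming (Decidable to Decidable₂)
import Relation.Binary.Construct.On as On
open import Relation.Binary.PropositionalEquality
  using (_≡_; _≢_; refl; sym; trans; cong; cong₂; subst; ≢-sym; setoid; module ≡-Reasoning)
open import Relation.Nullary using (¬_; Dec; yes; no; does; contradiction)
open import Relation.Nullary.Decidable using (dec-true; dec-false; T?; ¬?; _×-dec_; _⊎-dec_)

-- Switches in Boolean sequences

boolToℕ : Bool → ℕ
boolToℕ b = if b then 1 else 0

switches : List Bool → ℕ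
switches []           = 0
switches (_ ∷ [])     = 0
switches (b ∷ c ∷ bs) = boolToℕ (b xor c) + switches (c ∷ bs)

switches-const : ∀ {b bs} → All (_≡ b) bs → switches bs ≡ 0
switches-const []                         = refl
switches-const (refl ∷ [])                = refl
switches-const {true}  (refl ∷ refl ∷ ps) = switches-const (refl ∷ ps)
switches-const {false} (refl ∷ refl ∷ ps) = switches-const (refl ∷ ps)

switches-∷ : ∀ b bs → switches bs ≤ switches (b ∷ bs)
switches-∷ b []       = z≤n
switches-∷ b (c ∷ bs) = m≤n+m _ _

switches-++ : ∀ as bs → switches as + switches bs ≤ switches (as ++ bs)
switches-++ []            bs = ≤-refl
switches-++ (a ∷ [])      bs = switches-∷ a bs
switches-++ (a ∷ a′ ∷ as) bs = ≤-trans (≤-reflexive (+-assoc (boolToℕ (a xor a′)) _ _))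
                                       (+-monoʳ-≤ _ (switches-++ (a′ ∷ as) bs))

switches-++ˡ : ∀ as bs → switches as ≤ switches (as ++ bs)
switches-++ˡ as bs = ≤-trans (m≤m+n _ _) (switches-++ as bs)

switches-++ʳ : ∀ as bs → switches bs ≤ switches (as ++ bs)
switches-++ʳ as bs = ≤-trans (m≤n+m _ _) (switches-++ as bs)

switches-middle : ∀ as bs cs → switches bs ≤ switches (as ++ bs ++ cs)
switches-middle as bs cs = ≤-trans (switches-++ˡ bs cs) (switches-++ʳ as (bs ++ cs))

switches-outer : ∀ as bs cs → switches as + switches cs ≤ switches (as ++ bs ++ cs)
switches-outer as bs cs = ≤-trans (+-monoʳ-≤ (switches as) (switches-++ʳ bs cs)) (switches-++ as (bs ++ cs))

switches-concat-∈ : ∀ {bs bss} → bs ∈ bss → switches bs ≤ switches (concat bss)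
switches-concat-∈ {bs}           (here refl) = switches-++ˡ bs _
switches-concat-∈ {bss = cs ∷ _} (there p)   = ≤-trans (switches-concat-∈ p) (switches-++ʳ cs _)

switches-∉ : ∀ b bs → not b ∈ bs → 1 ≤ switches (b ∷ bs)
switches-∉ true  (false ∷ bs) _         = s≤s z≤n
switches-∉ false (true ∷ bs)  _         = s≤s z≤n
switches-∉ true  (true ∷ bs)  (there p) = switches-∉ true bs p
switches-∉ false (false ∷ bs) (there p) = switches-∉ false bs p

switches-both : ∀ {bs} → true ∈ bs → false ∈ bs → 1 ≤ switches bs
switches-both {true ∷ bs}  _ (there p) = switches-∉ true bs p
switches-both {false ∷ bs} (there p) _ = switches-∉ false bs p

data Ascending : List Bool → Set where
  all-true : ∀ {bs} → All (_≡ true) bs → Ascending bs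
  false∷_  : ∀ {bs} → Ascending bs → Ascending (false ∷ bs)

switches-ascending : ∀ {bs} → Ascending bs → switches bs ≤ 1
switches-ascending (all-true p)                 = ≤-trans (≤-reflexive (switches-const p)) z≤n
switches-ascending (false∷_ {[]} _)             = z≤n
switches-ascending (false∷ all-true (refl ∷ p)) = s≤s (≤-reflexive (switches-const (refl ∷ p)))
switches-ascending (false∷ (false∷ a))          = switches-ascending (false∷ a)

ascending-falses-++ : ∀ {as bs} → All (_≡ false) as → Ascending bs → Ascending (as ++ bs)
ascending-falses-++ []          a = a
ascending-falses-++ (refl ∷ ps) a = false∷ ascending-falses-++ ps a

ascending-++-trues : ∀ {as bs} → Ascending as → All (_≡ true) bs → Ascending (as ++ bs)
ascending-++-trues (all-true p) q = all-true (All.++⁺ p q)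
ascending-++-trues (false∷ a)   q = false∷ ascending-++-trues a q

module _ {I : Set} {_<_ : Rel I 0ℓ} (compare : Trichotomous _≡_ _<_) (<-trans : Transitive _<_)
         (F : I → List Bool) (τ : I)
         (before : ∀ {i} → i < τ → All (_≡ false) (F i))
         (at     : Ascending (F τ))
         (after  : ∀ {i} → τ < i → All (_≡ true) (F i)) where

  trues-concatMap : ∀ {is} → All (τ <_) is → All (_≡ true) (concatMap F is)
  trues-concatMap p = All.concat⁺ (All.map⁺ (All.map after p))

  ascending-concatMap : ∀ {is} → AllPairs _<_ is → Ascending (concatMap F is)
  ascending-concatMap []                               = all-true []
  ascending-concatMap {i ∷ is} (i<is ∷ sorted) with compare i τ
  ... | tri< i<τ _ _  = ascending-falses-++ (before i<τ) (ascending-concatMap sorted)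
  ... | tri≈ _ refl _ = ascending-++-trues at (trues-concatMap i<is)
  ... | tri> _ _ τ<i  = all-true (trues-concatMap (τ<i ∷ All.map (<-trans τ<i) i<is))

-- Words of permutations given by keys

module _ {n : ℕ} where

  isXY-sound : ∀ {x y z : Fin n} → T (isXY x y z) → z ≡ x ⊎ z ≡ y
  isXY-sound {x} {y} {z} t with z ≟ x | z ≟ y
  ... | yes z≡x | _       = inj₁ z≡x
  ... | no _    | yes z≡y = inj₂ z≡y

  isXY-complete : ∀ {x y z : Fin n} → z ≡ x ⊎ z ≡ y → T (isXY x y z)
  isXY-complete {x} {y} {z} p with z ≟ x | z ≟ y | p
  ... | yes _  | _      | _        = _
  ... | no _   | yes _  | _        = _
  ... | no z≢x | no _   | inj₁ z≡x = z≢x z≡x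
  ... | no _   | no z≢y | inj₂ z≡y = z≢y z≡y

  restrict-comm : ∀ (x y : Fin n) w → restrict x y w ≡ restrict y x w
  restrict-comm x y w = filter-≐ _ _ ( isXY-complete ∘ Sum.swap ∘ isXY-sound
                                    , isXY-complete ∘ Sum.swap ∘ isXY-sound ) w

  restrict-concat : ∀ (x y : Fin n) ws → restrict x y (concat ws) ≡ concatMap (restrict x y) ws
  restrict-concat x y []       = refl
  restrict-concat x y (w ∷ ws) =
    trans (filter-++ _ w (concat ws)) (cong (restrict x y w ++_) (restrict-concat x y ws))

  squaresFrom-∷ : ∀ (a b : Fin n) w → squaresFrom a (b ∷ w) ≡ boolToℕ (does (a ≟ b)) + squaresFrom b w
  squaresFrom-∷ a b w with a ≟ b
  ... | yes _ = refl
  ... | no _  = refl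

  module _ {x y : Fin n} (x≢y : x ≢ y) where

    choose : Bool → Fin n
    choose b = if b then x else y

    pairWord : Bool → Word n
    pairWord b = choose b ∷ choose (not b) ∷ []

    ≟-choose : ∀ b c → does (choose b ≟ choose c) ≡ not (b xor c)
    ≟-choose true  true  = dec-true (x ≟ x) refl
    ≟-choose true  false = dec-false (x ≟ y) x≢y
    ≟-choose false true  = dec-false (y ≟ x) (x≢y ∘ sym)
    ≟-choose false false = dec-true (y ≟ y) refl

    square-inside : ∀ b → does (choose b ≟ choose (not b)) ≡ false
    square-inside true  = ≟-choose true false
    square-inside false = ≟-choose false true

    square-between : ∀ b c → does (choose (not b) ≟ choose c) ≡ b xor c
    square-between true  c = ≟-choose false c
    square-between false c = trans (≟-choose true c) (not-involutive c)

    countSquares-pairWords : ∀ bs → countSquares (concatMap pairWord bs) ≡ switches bs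
    countSquares-pairWords []           = refl
    countSquares-pairWords (b ∷ [])     =
      trans (squaresFrom-∷ (choose b) (choose (not b)) []) (cong (λ d → boolToℕ d + 0) (square-inside b))
    countSquares-pairWords (b ∷ c ∷ bs) = begin
      squaresFrom (choose b) (choose (not b) ∷ choose c ∷ rest)
        ≡⟨ squaresFrom-∷ (choose b) (choose (not b)) _ ⟩
      boolToℕ (does (choose b ≟ choose (not b))) + squaresFrom (choose (not b)) (choose c ∷ rest)
        ≡⟨ cong₂ _+_ (cong boolToℕ (square-inside b)) (squaresFrom-∷ (choose (not b)) (choose c) _) ⟩
      boolToℕ (does (choose (not b) ≟ choose c)) + countSquares (concatMap pairWord (c ∷ bs))
        ≡⟨ cong₂ _+_ (cong boolToℕ (square-between b c)) (countSquares-pairWords (c ∷ bs)) ⟩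
      switches (b ∷ c ∷ bs) ∎
      where
      rest = choose (not c) ∷ concatMap pairWord bs
      open ≡-Reasoning

  twoElements⇒pairWord : ∀ {x y : Fin n} (x≢y : x ≢ y) {r} → Unique r → All (λ z → z ≡ x ⊎ z ≡ y) r →
                         x ∈ r → y ∈ r → ∃ λ b → r ≡ pairWord x≢y b
  twoElements⇒pairWord x≢y _ _ (here refl) (here refl) = ⊥-elim (x≢y refl)
  twoElements⇒pairWord x≢y _ (_ ∷ []) (here refl) (there ())
  twoElements⇒pairWord x≢y _ (_ ∷ []) (there ()) _
  twoElements⇒pairWord x≢y _ (inj₁ refl ∷ inj₂ refl ∷ []) _ _ = true , refl
  twoElements⇒pairWord x≢y _ (inj₂ refl ∷ inj₁ refl ∷ []) _ _ = false , refl
  twoElements⇒pairWord x≢y ((a≢b ∷ _) ∷ _) (inj₁ refl ∷ inj₁ refl ∷ _) _ _ = ⊥-elim (a≢b refl)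
  twoElements⇒pairWord x≢y ((a≢b ∷ _) ∷ _) (inj₂ refl ∷ inj₂ refl ∷ _) _ _ = ⊥-elim (a≢b refl)
  twoElements⇒pairWord x≢y ((_ ∷ a≢c ∷ _) ∷ _) (inj₁ refl ∷ inj₂ refl ∷ inj₁ refl ∷ _) _ _ = ⊥-elim (a≢c refl)
  twoElements⇒pairWord x≢y (_ ∷ (b≢c ∷ _) ∷ _) (inj₁ refl ∷ inj₂ refl ∷ inj₂ refl ∷ _) _ _ = ⊥-elim (b≢c refl)
  twoElements⇒pairWord x≢y ((_ ∷ a≢c ∷ _) ∷ _) (inj₂ refl ∷ inj₁ refl ∷ inj₂ refl ∷ _) _ _ = ⊥-elim (a≢c refl)
  twoElements⇒pairWord x≢y (_ ∷ (b≢c ∷ _) ∷ _) (inj₂ refl ∷ inj₁ refl ∷ inj₁ refl ∷ _) _ _ = ⊥-elim (b≢c refl)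

  lexKey : (Fin n → ℕ) → Fin n → ℕ
  lexKey g z = toℕ z + n * g z

  lexKey<n*suc : ∀ g z → lexKey g z < n * suc (g z)
  lexKey<n*suc g z = subst (lexKey g z <_) (sym (*-suc n (g z))) (+-monoˡ-< (n * g z) (toℕ<n z))

  lexKey-mono : ∀ g {a b} → g a < g b → lexKey g a < lexKey g b
  lexKey-mono g {a} {b} ga<gb =
    <-≤-trans (lexKey<n*suc g a) (≤-trans (*-monoʳ-≤ n ga<gb) (m≤n+m _ (toℕ b)))

  lexKey-injective : ∀ g {a b} → lexKey g a ≡ lexKey g b → a ≡ b
  lexKey-injective g {a} {b} eq with ℕₚ.<-cmp (g a) (g b)
  ... | tri< ga<gb _ _ = contradiction eq (<⇒≢ (lexKey-mono g ga<gb))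
  ... | tri≈ _ ga≡gb _ =
    toℕ-injective (+-cancelʳ-≡ _ _ _ (trans eq (cong (λ k → toℕ b + n * k) (sym ga≡gb))))
  ... | tri> _ _ gb<ga = contradiction eq (≢-sym (<⇒≢ (lexKey-mono g gb<ga)))

  module KeySort (g : Fin n → ℕ) = Data.List.Sort (On.decTotalOrder ≤-decTotalOrder (lexKey g))

  rankWord : (Fin n → ℕ) → Word n
  rankWord g = KeySort.sort g (allFin n)

  rankWord-isPermutation : ∀ g → IsPermutation (rankWord g)
  rankWord-isPermutation g = KeySort.sort-↭ g (allFin n)

  precedes : Fin n → Fin n → (Fin n → ℕ) → Bool
  precedes x y g = does (lexKey g x <? lexKey g y)

  precedes-true : ∀ {x y} g → g x < g y → precedes x y g ≡ true
  precedes-true {x} {y} g gx<gy = dec-true (lexKey g x <? lexKey g y) (lexKey-mono g gx<gy)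

  precedes-false : ∀ {x y} g → g y < g x → precedes x y g ≡ false
  precedes-false {x} {y} g gy<gx = dec-false (lexKey g x <? lexKey g y) (<-asym (lexKey-mono g gy<gx))

  restrict-rankWord : ∀ {x y} (x≢y : x ≢ y) g → restrict x y (rankWord g) ≡ pairWord x≢y (precedes x y g)
  restrict-rankWord {x} {y} x≢y g =
    fromShape (twoElements⇒pairWord x≢y unique pair (member (inj₁ refl)) (member (inj₂ refl)))
    where
    open KeySort g
    open import Data.List.Relation.Binary.Permutation.Setoid.Properties (setoid (Fin n)) using (Unique-resp-↭)
    open import Data.List.Relation.Unary.Sorted.TotalOrder (On.totalOrder ≤-totalOrder (lexKey g)) using (Sorted)
    r : Word n
    r = restrict x y (rankWord g)
    allFin↭ : allFin n ↭ rankWord g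
    allFin↭ = ↭-sym (sort-↭ (allFin n))
    unique : Unique r
    unique = Unique.filter⁺ _ (Unique-resp-↭ (↭⇒↭ₛ allFin↭) (Unique.allFin⁺ n))
    pair : All (λ z → z ≡ x ⊎ z ≡ y) r
    pair = All.map isXY-sound (All.all-filter _ (rankWord g))
    member : ∀ {z} → z ≡ x ⊎ z ≡ y → z ∈ r
    member {z} p = ∈-filter⁺ _ (∈-resp-↭ allFin↭ (∈-allFin z)) (isXY-complete p)
    sorted : Sorted r
    sorted = Sortedₚ.filter⁺ (On.totalOrder ≤-totalOrder (lexKey g)) _ (sort-↗ (allFin n))
    sorted-pair : ∀ b → Sorted (pairWord x≢y b) → b ≡ precedes x y g
    sorted-pair true  (x≤y Linked.∷ _) = sym (dec-true (_ <? _) (≤∧≢⇒< x≤y (x≢y ∘ lexKey-injective g)))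
    sorted-pair false (y≤x Linked.∷ _) = sym (dec-false (_ <? _) (≤⇒≯ y≤x))
    fromShape : (∃ λ b → r ≡ pairWord x≢y b) → r ≡ pairWord x≢y (precedes x y g)
    fromShape (b , r≡pair) = trans r≡pair (cong (pairWord x≢y) (sorted-pair b (subst Sorted r≡pair sorted)))

  countSquares-restrict : ∀ {x y} (x≢y : x ≢ y) gs →
    countSquares (restrict x y (concatMap rankWord gs)) ≡ switches (map (precedes x y) gs)
  countSquares-restrict {x} {y} x≢y gs = begin
    countSquares (restrict x y (concat (map rankWord gs)))
      ≡⟨ cong countSquares (restrict-concat x y (map rankWord gs)) ⟩
    countSquares (concat (map (restrict x y) (map rankWord gs)))
      ≡⟨ cong (countSquares ∘ concat) (trans (sym (map-∘ gs))
                                             (trans (map-cong (restrict-rankWord x≢y) gs) (map-∘ gs))) ⟩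
    countSquares (concatMap (pairWord x≢y) (map (precedes x y) gs))
      ≡⟨ countSquares-pairWords x≢y (map (precedes x y) gs) ⟩
    switches (map (precedes x y) gs) ∎
    where open ≡-Reasoning

-- Linear extensions by counting predecessors

module _ {n : ℕ} {_≺_ : Rel (Fin n) 0ℓ} (_≺?_ : Decidable₂ _≺_) where

  height : Fin n → ℕ
  height v = length (filter (_≺? v) (allFin n))

  height≤n : ∀ v → height v ≤ n
  height≤n v = subst (height v ≤_) (length-tabulate id) (length-filter (_≺? v) (allFin n))

  height-mono : Transitive _≺_ → Asymmetric _≺_ → ∀ {u v} → u ≺ v → height u < height v
  height-mono ≺-trans ≺-asym {u} {v} u≺v = begin-strict
    length (filter (_≺? u) (allFin n))                   ≡⟨ cong length (filter-absorb (allFin n)) ⟨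
    length (filter (_≺? u) (filter (_≺? v) (allFin n))) <⟨ filter-notAll (_≺? u) _ u∉ ⟩
    length (filter (_≺? v) (allFin n))                   ∎
    where
    open ≤-Reasoning
    u∉ : Any (λ w → ¬ w ≺ u) (filter (_≺? v) (allFin n))
    u∉ = lose (∈-filter⁺ (_≺? v) (∈-allFin u) u≺v) (λ u≺u → ≺-asym u≺u u≺u)
    filter-absorb : ∀ ws → filter (_≺? u) (filter (_≺? v) ws) ≡ filter (_≺? u) ws
    filter-absorb []       = refl
    filter-absorb (w ∷ ws) with w ≺? v
    ... | no w⊀v = trans (filter-absorb ws) (sym (filter-reject (_≺? u) (w⊀v ∘ flip ≺-trans u≺v)))
    ... | yes _ with does (w ≺? u)
    ...   | true  = cong (w ∷_) (filter-absorb ws)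
    ...   | false = filter-absorb ws

module _ (k : ℕ) where

  offset : ∀ {P : Set} → Dec P → ℕ
  offset p = if does p then 0 else k

  offset≤ : ∀ {P : Set} (p : Dec P) → offset p ≤ k
  offset≤ (yes _) = z≤n
  offset≤ (no _)  = ≤-refl

  offset-yes : ∀ {P : Set} (p : Dec P) → P → offset p ≡ 0
  offset-yes p pp = cong (if_then 0 else k) (dec-true p pp)

  offset-no : ∀ {P : Set} (p : Dec P) → ¬ P → offset p ≡ k
  offset-no p ¬pp = cong (if_then 0 else k) (dec-false p ¬pp)

  offset-< : ∀ {P Q : Set} (p : Dec P) (q : Dec Q) {a c} → (Q → P) → a < c → a < k →
             offset p + a < offset q + c
  offset-< (yes _) (yes _) _   a<c _   = a<c
  offset-< (yes _) (no _)  _   _   a<k = <-≤-trans a<k (m≤m+n _ _)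
  offset-< (no ¬p) (yes q) q⇒p _   _   = contradiction (q⇒p q) ¬p
  offset-< (no _)  (no _)  _   a<c _   = +-monoʳ-< k a<c

<-rewrite : ∀ {a a′ b b′} → a ≡ a′ → b ≡ b′ → a′ < b′ → a < b
<-rewrite refl refl a′<b′ = a′<b′

even<odd : ∀ {t r} → t ≤ r → 2 * t < suc (2 * r)
even<odd t≤r = s≤s (*-monoʳ-≤ 2 t≤r)

odd<even : ∀ {r t} → r < t → suc (2 * r) < 2 * t
odd<even {r} {t} r<t = subst (_≤ 2 * t) (*-suc 2 r) (*-monoʳ-≤ 2 r<t)

All-if : ∀ {X : Set} {P : X → Set} b {xs ys} → All P xs → All P ys → All P (if b then xs else ys)
All-if true  p _ = p
All-if false _ q = q

-- The representing sequence of permutations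

module Construction {n : ℕ} (G : Graph n) (A : Subset n) (O : Fin n → Fin n → Set)
  (O-sound    : ∀ x y → O x y → In A x × In A y × Edge G x y)
  (O-complete : ∀ x y → In A x → In A y → Edge G x y → O x y ⊎ O y x)
  (O-asym     : ∀ x y → O x y → ¬ O y x)
  (O-trans    : ∀ x y z → O x y → O y z → O x z) where

  edge-sym : ∀ {x y} → Edge G x y → Edge G y x
  edge-sym {x} {y} = subst T (Graph.sym G x y)

  O? : Decidable₂ O
  O? x y with T? (A x) ×-dec T? (A y) ×-dec T? (adj G x y)
  ... | yes (x∈A , y∈A , xy) =
    Sum.[ yes , (λ Oyx → no (λ Oxy → O-asym x y Oxy Oyx)) ]′ (O-complete x y x∈A y∈A xy)
  ... | no ¬xy = no (¬xy ∘ O-sound x y)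

  rank : Fin n → ℕ
  rank = lexKey (height O?)

  rankLimit : ℕ
  rankLimit = n * suc n

  rank<rankLimit : ∀ z → rank z < rankLimit
  rank<rankLimit z = <-≤-trans (lexKey<n*suc (height O?) z) (*-monoʳ-≤ n (s≤s (height≤n O? z)))

  rank-mono : ∀ {u v} → O u v → rank u < rank v
  rank-mono = lexKey-mono (height O?) ∘ height-mono O? (λ {x} {y} {z} → O-trans x y z) (λ {x} {y} → O-asym x y)

  rank-injective : ∀ {u v} → rank u ≡ rank v → u ≡ v
  rank-injective = lexKey-injective (height O?)

  DownSet : Fin n → Fin n → Set
  DownSet w z = z ≡ w ⊎ O z w

  downSet? : Decidable₂ DownSet
  downSet? w z = (z ≟ w) ⊎-dec O? z w

  downSet-closed : ∀ {w u v} → O u v → DownSet w v → DownSet w u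
  downSet-closed         Ouv (inj₁ refl) = inj₂ Ouv
  downSet-closed {w} {u} {v} Ouv (inj₂ Ovw) = inj₂ (O-trans u v w Ouv Ovw)

  downSetKey : Fin n → Fin n → ℕ
  downSetKey w z = offset rankLimit (downSet? w z) + rank z

  downSetKey-mono : ∀ w {u v} → O u v → downSetKey w u < downSetKey w v
  downSetKey-mono w {u} {v} Ouv =
    offset-< rankLimit (downSet? w u) (downSet? w v) (downSet-closed Ouv) (rank-mono Ouv) (rank<rankLimit u)

  downSetKey-self : ∀ {x y} → ¬ DownSet x y → downSetKey x x < downSetKey x y
  downSetKey-self {x} {y} y∉↓x = begin-strict
    downSetKey x x      ≡⟨ cong (_+ rank x) (offset-yes rankLimit (downSet? x x) (inj₁ refl)) ⟩
    rank x              <⟨ rank<rankLimit x ⟩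
    rankLimit           ≤⟨ m≤m+n _ _ ⟩
    rankLimit + rank y  ≡⟨ cong (_+ rank y) (offset-no rankLimit (downSet? x y) y∉↓x) ⟨
    downSetKey x y      ∎
    where open ≤-Reasoning

  downSetKey<2*rankLimit : ∀ w z → downSetKey w z < 2 * rankLimit
  downSetKey<2*rankLimit w z = subst (downSetKey w z <_) (cong (rankLimit +_) (sym (+-identityʳ rankLimit)))
    (+-mono-≤-< (offset≤ rankLimit (downSet? w z)) (rank<rankLimit z))

  pointKey : Fin n → Fin n → ℕ
  pointKey w z = offset 1 (z ≟ w)

  pointKey-self : ∀ {u v} → v ≢ u → pointKey u u < pointKey u v
  pointKey-self {u} {v} v≢u = <-rewrite (offset-yes 1 (u ≟ u) refl) (offset-no 1 (v ≟ u) v≢u) (s≤s z≤n)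

  lowKey highKey : Fin n → Fin n → ℕ
  lowKey  w z = if A z then 2 + downSetKey w z else pointKey w z
  highKey w z = if A z then downSetKey w z else 2 * rankLimit + pointKey w z

  -- While y is swept at time t, the vertices of A stand at the odd positions 2 rank + 1 and y at
  -- the even position 2t, so y passes the vertex of rank r between the times r and r + 1.  The
  -- rest of B waits in front if its sweep is still to come, and at the back otherwise.
  parkKey : Fin n → ℕ → Fin n → ℕ
  parkKey y t z with Finₚ.<-cmp z y
  ... | tri< _ _ _ = 2 * rankLimit
  ... | tri≈ _ _ _ = 2 * t
  ... | tri> _ _ _ = 0

  sweepKey : Fin n → ℕ → Fin n → ℕ
  sweepKey y t z = if A z then suc (2 * rank z) else parkKey y t z

  parkKey-done : ∀ {y z} t → z Fin.< y → parkKey y t z ≡ 2 * rankLimit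
  parkKey-done {y} {z} t z<y with Finₚ.<-cmp z y
  ... | tri< _ _ _   = refl
  ... | tri≈ z≮y _ _ = contradiction z<y z≮y
  ... | tri> z≮y _ _ = contradiction z<y z≮y

  parkKey-self : ∀ y t → parkKey y t y ≡ 2 * t
  parkKey-self y t with Finₚ.<-cmp y y
  ... | tri< _ y≢y _ = contradiction refl y≢y
  ... | tri≈ _ _ _   = refl
  ... | tri> _ y≢y _ = contradiction refl y≢y

  parkKey-pending : ∀ {y z} t → y Fin.< z → parkKey y t z ≡ 0
  parkKey-pending {y} {z} t y<z with Finₚ.<-cmp z y
  ... | tri< _ _ z≯y = contradiction y<z z≯y
  ... | tri≈ _ _ z≯y = contradiction y<z z≯y
  ... | tri> _ _ _   = refl

  NonNeighbourAt : Fin n → ℕ → Set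
  NonNeighbourAt y j = ∃ λ z → ¬ Edge G y z × rank z ≡ j

  nonNeighbourAt? : ∀ y j → Dec (NonNeighbourAt y j)
  nonNeighbourAt? y j = Finₚ.any? (λ z → ¬? (T? (adj G y z)) ×-dec (rank z ≟ℕ j))

  oscillation passage stage : Fin n → ℕ → List (Fin n → ℕ)
  oscillation y j = sweepKey y j ∷ sweepKey y (suc j) ∷ sweepKey y j ∷ sweepKey y (suc j) ∷ []
  passage     y j = sweepKey y (suc j) ∷ []
  stage       y j = if does (nonNeighbourAt? y j) then oscillation y j else passage y j

  stage-oscillates : ∀ {y j} → NonNeighbourAt y j → stage y j ≡ oscillation y j
  stage-oscillates {y} {j} nn =
    cong (if_then oscillation y j else passage y j) (dec-true (nonNeighbourAt? y j) nn)

  stage-passes : ∀ {y j} → ¬ NonNeighbourAt y j → stage y j ≡ passage y j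
  stage-passes {y} {j} ¬nn =
    cong (if_then oscillation y j else passage y j) (dec-false (nonNeighbourAt? y j) ¬nn)

  sweep : Fin n → List (Fin n → ℕ)
  sweep y = concatMap (stage y) (upTo rankLimit)

  lowKeys sweepKeys highKeys keys : List (Fin n → ℕ)
  lowKeys   = map lowKey (allFin n)
  sweepKeys = concatMap sweep (allFin n)
  highKeys  = map highKey (allFin n)
  keys      = lowKeys ++ sweepKeys ++ highKeys

  All-stage : ∀ {P : (Fin n → ℕ) → Set} y j → (∀ t → j ≤ t → t ≤ suc j → P (sweepKey y t)) → All P (stage y j)
  All-stage y j p = All-if (does (nonNeighbourAt? y j)) (now ∷ next ∷ now ∷ next ∷ []) (next ∷ [])
    where
    now  = p j ≤-refl (n≤1+n j)
    next = p (suc j) (n≤1+n j) ≤-refl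

  All-sweep : ∀ {P : (Fin n → ℕ) → Set} y → (∀ t → P (sweepKey y t)) → All P (sweep y)
  All-sweep y p =
    All.concat⁺ (All.map⁺ {f = stage y} (All.universal (λ j → All-stage y j (λ t _ _ → p t)) (upTo rankLimit)))

  All-keys : ∀ {P : (Fin n → ℕ) → Set} → (∀ w → P (lowKey w)) → (∀ y t → P (sweepKey y t)) →
             (∀ w → P (highKey w)) → All P keys
  All-keys low mid high = All.++⁺ (All.map⁺ (All.universal low (allFin n)))
    (All.++⁺ (All.concat⁺ (All.map⁺ {f = sweep} (All.universal (λ y → All-sweep y (mid y)) (allFin n))))
             (All.map⁺ (All.universal high (allFin n))))

  map-keys : ∀ (f : (Fin n → ℕ) → Bool) → map f keys ≡ map f lowKeys ++ map f sweepKeys ++ map f highKeys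
  map-keys f = trans (map-++ f lowKeys _) (cong (map f lowKeys ++_) (map-++ f sweepKeys highKeys))

  module _ {z} (z∈A : A z ≡ true) where

    lowKey-A : ∀ w → lowKey w z ≡ 2 + downSetKey w z
    lowKey-A w = cong (if_then 2 + downSetKey w z else pointKey w z) z∈A

    highKey-A : ∀ w → highKey w z ≡ downSetKey w z
    highKey-A w = cong (if_then downSetKey w z else 2 * rankLimit + pointKey w z) z∈A

    sweepKey-A : ∀ y t → sweepKey y t z ≡ suc (2 * rank z)
    sweepKey-A y t = cong (if_then suc (2 * rank z) else parkKey y t z) z∈A

  module _ {z} (z∉A : A z ≡ false) where

    lowKey-B : ∀ w → lowKey w z ≡ pointKey w z
    lowKey-B w = cong (if_then 2 + downSetKey w z else pointKey w z) z∉A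

    highKey-B : ∀ w → highKey w z ≡ 2 * rankLimit + pointKey w z
    highKey-B w = cong (if_then downSetKey w z else 2 * rankLimit + pointKey w z) z∉A

    sweepKey-B : ∀ y t → sweepKey y t z ≡ parkKey y t z
    sweepKey-B y t = cong (if_then suc (2 * rank z) else parkKey y t z) z∉A

  word : Word n
  word = concatMap rankWord keys

  bits : Fin n → Fin n → List Bool
  bits x y = map (precedes x y) keys

  switches-comparable : ∀ {x y} → O x y → switches (bits x y) ≡ 0
  switches-comparable {x} {y} Oxy = switches-const (All.map⁺ (All.map (λ {g} → precedes-true {x = x} {y = y} g)
    (All-keys (λ w → <-rewrite (lowKey-A x∈A w) (lowKey-A y∈A w) (s≤s (s≤s (downSetKey-mono w Oxy))))
              (λ v t → <-rewrite (sweepKey-A x∈A v t) (sweepKey-A y∈A v t) (s≤s (*-monoʳ-< 2 (rank-mono Oxy))))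
              (λ w → <-rewrite (highKey-A x∈A w) (highKey-A y∈A w) (downSetKey-mono w Oxy)))))
    where
    x∈A : A x ≡ true
    x∈A = Equivalence.to T-≡ (proj₁ (O-sound x y Oxy))
    y∈A : A y ≡ true
    y∈A = Equivalence.to T-≡ (proj₁ (proj₂ (O-sound x y Oxy)))

  2≤switches-if-both-orders : ∀ {x y} →
    (∃ λ w → lowKey w x < lowKey w y) → (∃ λ w → lowKey w y < lowKey w x) →
    (∃ λ w → highKey w x < highKey w y) → (∃ λ w → highKey w y < highKey w x) → 2 ≤ switches (bits x y)
  2≤switches-if-both-orders {x} {y} low< low> high< high> =
    subst (λ bs → 2 ≤ switches bs) (sym (map-keys (precedes x y)))
      (≤-trans (+-mono-≤ (both lowKey low< low>) (both highKey high< high>))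
               (switches-outer (bitsOf lowKey) (map (precedes x y) sweepKeys) (bitsOf highKey)))
    where
    bitsOf : (Fin n → Fin n → ℕ) → List Bool
    bitsOf key = map (precedes x y) (map key (allFin n))
    both : (key : Fin n → Fin n → ℕ) → ∃ (λ w → key w x < key w y) → ∃ (λ w → key w y < key w x) →
           1 ≤ switches (bitsOf key)
    both key (w , lt) (w′ , gt) =
      switches-both (hit w (precedes-true (key w) lt)) (hit w′ (precedes-false (key w′) gt))
      where
      hit : ∀ v {b} → precedes x y (key v) ≡ b → b ∈ bitsOf key
      hit v eq = subst (_∈ _) eq (∈-map⁺ _ (∈-map⁺ key (∈-allFin v)))

  2≤switches-incomparable : ∀ {x y} → A x ≡ true → A y ≡ true → x ≢ y → ¬ O x y → ¬ O y x →
                            2 ≤ switches (bits x y)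
  2≤switches-incomparable {x} {y} x∈A y∈A x≢y ¬Oxy ¬Oyx = 2≤switches-if-both-orders
    (x , <-rewrite (lowKey-A x∈A x) (lowKey-A y∈A x) (s≤s (s≤s (downSetKey-self y∉↓x))))
    (y , <-rewrite (lowKey-A y∈A y) (lowKey-A x∈A y) (s≤s (s≤s (downSetKey-self x∉↓y))))
    (x , <-rewrite (highKey-A x∈A x) (highKey-A y∈A x) (downSetKey-self y∉↓x))
    (y , <-rewrite (highKey-A y∈A y) (highKey-A x∈A y) (downSetKey-self x∉↓y))
    where
    y∉↓x : ¬ DownSet x y
    y∉↓x = Sum.[ x≢y ∘ sym , ¬Oyx ]
    x∉↓y : ¬ DownSet y x
    x∉↓y = Sum.[ x≢y , ¬Oxy ]

  2≤switches-outside : ∀ {x y} → A x ≡ false → A y ≡ false → x ≢ y → 2 ≤ switches (bits x y)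
  2≤switches-outside {x} {y} x∉A y∉A x≢y = 2≤switches-if-both-orders
    (x , <-rewrite (lowKey-B x∉A x) (lowKey-B y∉A x) (pointKey-self (x≢y ∘ sym)))
    (y , <-rewrite (lowKey-B y∉A y) (lowKey-B x∉A y) (pointKey-self x≢y))
    (x , <-rewrite (highKey-B x∉A x) (highKey-B y∉A x)
                   (+-monoʳ-< (2 * rankLimit) (pointKey-self (x≢y ∘ sym))))
    (y , <-rewrite (highKey-B y∉A y) (highKey-B x∉A y)
                   (+-monoʳ-< (2 * rankLimit) (pointKey-self x≢y)))
  module _ {x y} (x∈A : A x ≡ true) (y∉A : A y ≡ false) where

    private
      f : (Fin n → ℕ) → Bool
      f = precedes x y

    low-false : ∀ w → f (lowKey w) ≡ false
    low-false w = precedes-false (lowKey w)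
      (<-rewrite (lowKey-B y∉A w) (lowKey-A x∈A w) (≤-trans (s≤s (offset≤ 1 (y ≟ w))) (m≤m+n 2 _)))

    high-true : ∀ w → f (highKey w) ≡ true
    high-true w = precedes-true (highKey w)
      (<-rewrite (highKey-A x∈A w) (highKey-B y∉A w) (<-≤-trans (downSetKey<2*rankLimit w x) (m≤m+n _ _)))

    sweep-before : ∀ {v} t → v Fin.< y → f (sweepKey v t) ≡ false
    sweep-before {v} t v<y = precedes-false (sweepKey v t)
      (<-rewrite (trans (sweepKey-B y∉A v t) (parkKey-pending t v<y)) (sweepKey-A x∈A v t) (s≤s z≤n))

    sweep-after : ∀ {v} t → y Fin.< v → f (sweepKey v t) ≡ true
    sweep-after {v} t y<v = precedes-true (sweepKey v t)
      (<-rewrite (sweepKey-A x∈A v t) (trans (sweepKey-B y∉A v t) (parkKey-done t y<v))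
                 (odd<even (rank<rankLimit x)))

    sweep-own-before : ∀ {t} → t ≤ rank x → f (sweepKey y t) ≡ false
    sweep-own-before {t} t≤rx = precedes-false (sweepKey y t)
      (<-rewrite (trans (sweepKey-B y∉A y t) (parkKey-self y t)) (sweepKey-A x∈A y t) (even<odd t≤rx))

    sweep-own-after : ∀ {t} → rank x < t → f (sweepKey y t) ≡ true
    sweep-own-after {t} rx<t = precedes-true (sweepKey y t)
      (<-rewrite (sweepKey-A x∈A y t) (trans (sweepKey-B y∉A y t) (parkKey-self y t)) (odd<even rx<t))

    map-sweep : ∀ v → map f (sweep v) ≡ concatMap (map f ∘ stage v) (upTo rankLimit)
    map-sweep v = map-concatMap f (stage v) (upTo rankLimit)

    map-sweepKeys : map f sweepKeys ≡ concatMap (map f ∘ sweep) (allFin n)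
    map-sweepKeys = map-concatMap f sweep (allFin n)

    ascending-own-sweep : ¬ NonNeighbourAt y (rank x) → Ascending (map f (sweep y))
    ascending-own-sweep ¬nn = subst Ascending (sym (map-sweep y))
      (ascending-concatMap ℕₚ.<-cmp ℕₚ.<-trans (map f ∘ stage y) (rank x) before at after
        (AllPairs.applyUpTo⁺₁ id rankLimit (λ i<j _ → i<j)))
      where
      before : ∀ {j} → j < rank x → All (_≡ false) (map f (stage y j))
      before {j} j<rx = All.map⁺ (All-stage y j (λ t _ t≤1+j → sweep-own-before (≤-trans t≤1+j j<rx)))
      at : Ascending (map f (stage y (rank x)))
      at = subst (Ascending ∘ map f) (sym (stage-passes ¬nn)) (all-true (sweep-own-after (n<1+n (rank x)) ∷ []))
      after : ∀ {j} → rank x < j → All (_≡ true) (map f (stage y j))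
      after {j} rx<j = All.map⁺ (All-stage y j (λ t j≤t _ → sweep-own-after (<-≤-trans rx<j j≤t)))

    edge⇒ascending : Edge G x y → Ascending (bits x y)
    edge⇒ascending xy = subst Ascending (sym (map-keys f))
      (ascending-falses-++ (All.map⁺ (All.map⁺ (All.universal low-false (allFin n))))
        (ascending-++-trues (subst Ascending (sym map-sweepKeys) sweeps)
          (All.map⁺ (All.map⁺ (All.universal high-true (allFin n))))))
      where
      ¬nn : ¬ NonNeighbourAt y (rank x)
      ¬nn (z , ¬yz , rz≡rx) with rank-injective rz≡rx
      ... | refl = ¬yz (edge-sym xy)
      sweeps : Ascending (concatMap (map f ∘ sweep) (allFin n))
      sweeps = ascending-concatMap Finₚ.<-cmp Finₚ.<-trans (map f ∘ sweep) y
        (λ v<y → All.map⁺ (All-sweep _ (λ t → sweep-before t v<y)))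
        (ascending-own-sweep ¬nn)
        (λ y<v → All.map⁺ (All-sweep _ (λ t → sweep-after t y<v)))
        (AllPairs.tabulate⁺-< id)

    nonEdge⇒2≤switches : ¬ Edge G x y → 2 ≤ switches (bits x y)
    nonEdge⇒2≤switches ¬xy = begin
      2
        ≤⟨ n≤1+n 2 ⟩
      switches (false ∷ true ∷ false ∷ true ∷ [])
        ≡⟨ cong switches oscillation-bits ⟨
      switches (map f (oscillation y (rank x)))
        ≡⟨ cong (switches ∘ map f) (stage-oscillates nn) ⟨
      switches (map f (stage y (rank x)))
        ≤⟨ switches-concat-∈ (∈-map⁺ (map f ∘ stage y) (∈-upTo⁺ (rank<rankLimit x))) ⟩
      switches (concatMap (map f ∘ stage y) (upTo rankLimit))
        ≡⟨ cong switches (map-sweep y) ⟨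
      switches (map f (sweep y))
        ≤⟨ switches-concat-∈ (∈-map⁺ (map f ∘ sweep) (∈-allFin y)) ⟩
      switches (concatMap (map f ∘ sweep) (allFin n))
        ≡⟨ cong switches map-sweepKeys ⟨
      switches (map f sweepKeys)
        ≤⟨ switches-middle (map f lowKeys) _ (map f highKeys) ⟩
      switches (map f lowKeys ++ map f sweepKeys ++ map f highKeys)
        ≡⟨ cong switches (map-keys f) ⟨
      switches (bits x y) ∎
      where
      open ≤-Reasoning
      nn : NonNeighbourAt y (rank x)
      nn = x , (¬xy ∘ edge-sym) , refl
      oscillation-bits : map f (oscillation y (rank x)) ≡ false ∷ true ∷ false ∷ true ∷ []
      oscillation-bits =
        cong₂ (λ b c → b ∷ c ∷ b ∷ c ∷ []) (sweep-own-before ≤-refl) (sweep-own-after (n<1+n (rank x)))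

  Represented : Fin n → Fin n → Set
  Represented x y = (Edge G x y → switches (bits x y) ≤ 1) × (¬ Edge G x y → 2 ≤ switches (bits x y))

  switches-bits-comm : ∀ {x y} → x ≢ y → switches (bits x y) ≡ switches (bits y x)
  switches-bits-comm {x} {y} x≢y = begin
    switches (bits x y)           ≡⟨ countSquares-restrict x≢y keys ⟨
    countSquares (restrict x y word) ≡⟨ cong countSquares (restrict-comm x y word) ⟩
    countSquares (restrict y x word) ≡⟨ countSquares-restrict (x≢y ∘ sym) keys ⟩
    switches (bits y x)           ∎
    where open ≡-Reasoning

  represented-sym : ∀ {x y} → x ≢ y → Represented y x → Represented x y
  represented-sym x≢y (upper , lower) =
      (λ xy → subst (_≤ 1) (sym comm) (upper (edge-sym xy)))
    , (λ ¬xy → subst (2 ≤_) (sym comm) (lower (¬xy ∘ edge-sym)))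
    where comm = switches-bits-comm x≢y

  represented-comparable : ∀ {x y} → O x y → Represented x y
  represented-comparable {x} {y} Oxy =
      (λ _ → subst (_≤ 1) (sym (switches-comparable Oxy)) z≤n)
    , (λ ¬xy → contradiction (proj₂ (proj₂ (O-sound x y Oxy))) ¬xy)

  represented : Independent G (λ v → not (A v)) → ∀ {x y} → x ≢ y → Represented x y
  represented indep {x} {y} x≢y = byParts (A x) refl (A y) refl
    where
    insideA : A x ≡ true → A y ≡ true → Dec (O x y) → Dec (O y x) → Represented x y
    insideA _ _ (yes Oxy) _ = represented-comparable Oxy
    insideA _ _ (no _) (yes Oyx) = represented-sym x≢y (represented-comparable Oyx)
    insideA x∈A y∈A (no ¬Oxy) (no ¬Oyx) =
        (λ xy → ⊥-elim (Sum.[ ¬Oxy , ¬Oyx ]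
                         (O-complete x y (Equivalence.from T-≡ x∈A) (Equivalence.from T-≡ y∈A) xy)))
      , (λ _ → 2≤switches-incomparable x∈A y∈A x≢y ¬Oxy ¬Oyx)
    byParts : ∀ a → A x ≡ a → ∀ b → A y ≡ b → Represented x y
    byParts true  x∈A true  y∈A = insideA x∈A y∈A (O? x y) (O? y x)
    byParts true  x∈A false y∉A = switches-ascending ∘ edge⇒ascending x∈A y∉A , nonEdge⇒2≤switches x∈A y∉A
    byParts false x∉A true  y∈A =
      represented-sym x≢y (switches-ascending ∘ edge⇒ascending y∈A x∉A , nonEdge⇒2≤switches y∈A x∉A)
    byParts false x∉A false y∉A =
        (λ xy → ⊥-elim (indep x y (Equivalence.from T-not-≡ x∉A) (Equivalence.from T-not-≡ y∉A) xy))
      , (λ _ → 2≤switches-outside x∉A y∉A x≢y)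

  represents : Independent G (λ v → not (A v)) → Represents-1-11 G word
  represents indep x y x≢y = subst (λ c → (c ≤ 1) ⇔ Edge G x y) (sym (countSquares-restrict x≢y keys))
    (≤1⇔ (T? (adj G x y)) (represented indep x≢y))
    where
    ≤1⇔ : ∀ {P : Set} {c} → Dec P → (P → c ≤ 1) × (¬ P → 2 ≤ c) → (c ≤ 1 ⇔ P)
    ≤1⇔ (yes p) (upper , _) = mk⇔ (λ _ → p) upper
    ≤1⇔ (no ¬p) (_ , lower) =
      mk⇔ (λ c≤1 → contradiction (≤-trans (lower ¬p) c≤1) λ { (s≤s ()) }) (λ p → contradiction p ¬p)

mainTheorem8 : (n : ℕ) (G : Graph n) (A : Subset n) →
    Independent G (λ v → not (A v)) →
    InducedIsComparability G A →
    PermRep-1-11 G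
mainTheorem8 n G A indep (O , O-sound , O-complete , O-asym , O-trans) =
  map rankWord keys , All.map⁺ (All.universal rankWord-isPermutation keys) , represents indep
  where open Construction G A O O-sound O-complete O-asym O-trans
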